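{- Let $x, y, z$ be rational numbers with $1 + x^2 = y^2 + z^2$ and $x \neq z$. Then there exist rational numbers $a, b$ (with $a \neq b$) such that $$x = \frac{ab + 1}{a - b}, \qquad y = \frac{a + b}{a - b}, \qquad z = \frac{ab - 1}{a - b}.$$ -}

module Defs where

open import Data.Rational using (ℚ; 0ℚ; _+_; -_; _-_; NonZero; ≢-nonZero)
open import Data.Rational.Properties using (+-assoc; +-identityˡ; +-identityʳ; +-inverseˡ)
open import Relation.Binary.PropositionalEquality using (_≡_; _≢_; sym; trans; cong)

diff-nonZero : (a b : ℚ) → a ≢ b → NonZero (a - b)
diff-nonZero a b a≢b = ≢-nonZero λ eq → a≢b (lem eq)
  where
  lem : a - b ≡ 0ℚ → a ≡ b
  lem eq = trans (sym (+-identityʳ a))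
           (trans (cong (a +_) (sym (+-inverseˡ b)))
           (trans (sym (+-assoc a (- b) b))
           (trans (cong (_+ b) eq) (+-identityˡ b))))

{-# OPTIONS --safe #-}
module Submission where

open import Defs
open import Data.Rational using (ℚ; 0ℚ; 1ℚ; _+_; _-_; _*_; _÷_; 1/_; NonZero)
open import Data.Rational.Properties
  using (*-identityʳ; *-assoc; *-inverseʳ; *-zeroʳ; *-distribˡ-+; +-inverseʳ)
open import Data.Rational.Solver using (module +-*-Solver)
open import Data.Product using (Σ; ∃₂; _×_; _,_)
open import Relation.Binary.PropositionalEquality
open ≡-Reasoning
open +-*-Solver

-- Take a = (1 + y)/(x - z) and b = (y - 1)/(x - z), so that a - b = 2/(x - z) and
-- a + b = 2y/(x - z). Written as y² - 1 = x² - z², the hypothesis gives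
-- ab = (x + z)/(x - z), hence ab + 1 = 2x/(x - z) and ab - 1 = 2z/(x - z).

p*r≡q⇒p≡q÷r : ∀ {p q r} .{{_ : NonZero r}} → p * r ≡ q → p ≡ q ÷ r
p*r≡q⇒p≡q÷r {p} {q} {r} pr≡q = begin
  p                 ≡⟨ sym (*-identityʳ p) ⟩
  p * 1ℚ            ≡⟨ cong (p *_) (sym (*-inverseʳ r)) ⟩
  p * (r * (1/ r))  ≡⟨ sym (*-assoc p r (1/ r)) ⟩
  p * r * (1/ r)    ≡⟨ cong (_* 1/ r) pr≡q ⟩
  q * (1/ r)        ∎

y²-1≡x²-z² : ∀ x y z → 1ℚ + x * x ≡ y * y + z * z → y * y - 1ℚ ≡ x * x - z * z
y²-1≡x²-z² x y z h = begin
  y * y - 1ℚ                        ≡⟨ solve 2 (λ y z → y :* y :- con 1ℚ := (y :* y :+ z :* z) :- (con 1ℚ :+ z :* z)) refl y z ⟩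
  (y * y + z * z) - (1ℚ + z * z)    ≡⟨ cong (_- (1ℚ + z * z)) (sym h) ⟩
  (1ℚ + x * x) - (1ℚ + z * z)       ≡⟨ solve 2 (λ x z → (con 1ℚ :+ x :* x) :- (con 1ℚ :+ z :* z) := x :* x :- z :* z) refl x z ⟩
  x * x - z * z                     ∎

module Slopes (x y z : ℚ) (h : 1ℚ + x * x ≡ y * y + z * z) (x≢z : x ≢ z) where

  instance
    x-z≢0 : NonZero (x - z)
    x-z≢0 = diff-nonZero x z x≢z

  e : ℚ
  e = 1/ (x - z)

  [x-z]e≡1 : (x - z) * e ≡ 1ℚ
  [x-z]e≡1 = *-inverseʳ (x - z)

  a b : ℚ
  a = (1ℚ + y) * e
  b = (y - 1ℚ) * e

  a-b≡2e : a - b ≡ e + e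
  a-b≡2e = solve 2 (λ y e → (con 1ℚ :+ y) :* e :- (y :- con 1ℚ) :* e := e :+ e) refl y e

  a≢b : a ≢ b
  a≢b a≡b = 2≢0 (begin
    1ℚ + 1ℚ                       ≡⟨ sym (cong₂ _+_ [x-z]e≡1 [x-z]e≡1) ⟩
    (x - z) * e + (x - z) * e     ≡⟨ sym (*-distribˡ-+ (x - z) e e) ⟩
    (x - z) * (e + e)             ≡⟨ cong ((x - z) *_) (sym a-b≡2e) ⟩
    (x - z) * (a - b)             ≡⟨ cong (λ t → (x - z) * (t - b)) a≡b ⟩
    (x - z) * (b - b)             ≡⟨ cong ((x - z) *_) (+-inverseʳ b) ⟩
    (x - z) * 0ℚ                  ≡⟨ *-zeroʳ (x - z) ⟩
    0ℚ                            ∎)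
    where
    2≢0 : 1ℚ + 1ℚ ≢ 0ℚ
    2≢0 ()

  ab≡[x+z]e : a * b ≡ (x + z) * e
  ab≡[x+z]e = begin
    a * b                                ≡⟨ solve 2 (λ y e → (con 1ℚ :+ y) :* e :* ((y :- con 1ℚ) :* e) := (y :* y :- con 1ℚ) :* (e :* e)) refl y e ⟩
    (y * y - 1ℚ) * (e * e)               ≡⟨ cong (_* (e * e)) (y²-1≡x²-z² x y z h) ⟩
    (x * x - z * z) * (e * e)            ≡⟨ solve 3 (λ x z e → (x :* x :- z :* z) :* (e :* e) := (x :+ z) :* e :* ((x :- z) :* e)) refl x z e ⟩
    (x + z) * e * ((x - z) * e)          ≡⟨ cong ((x + z) * e *_) [x-z]e≡1 ⟩
    (x + z) * e * 1ℚ                     ≡⟨ *-identityʳ _ ⟩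
    (x + z) * e                          ∎

  x[a-b]≡ab+1 : x * (a - b) ≡ a * b + 1ℚ
  x[a-b]≡ab+1 = begin
    x * (a - b)                    ≡⟨ cong (x *_) a-b≡2e ⟩
    x * (e + e)                    ≡⟨ solve 3 (λ x z e → x :* (e :+ e) := (x :+ z) :* e :+ (x :- z) :* e) refl x z e ⟩
    (x + z) * e + (x - z) * e      ≡⟨ cong₂ _+_ (sym ab≡[x+z]e) [x-z]e≡1 ⟩
    a * b + 1ℚ                     ∎

  y[a-b]≡a+b : y * (a - b) ≡ a + b
  y[a-b]≡a+b = begin
    y * (a - b)                    ≡⟨ cong (y *_) a-b≡2e ⟩
    y * (e + e)                    ≡⟨ solve 2 (λ y e → y :* (e :+ e) := (con 1ℚ :+ y) :* e :+ (y :- con 1ℚ) :* e) refl y e ⟩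
    a + b                          ∎

  z[a-b]≡ab-1 : z * (a - b) ≡ a * b - 1ℚ
  z[a-b]≡ab-1 = begin
    z * (a - b)                    ≡⟨ cong (z *_) a-b≡2e ⟩
    z * (e + e)                    ≡⟨ solve 3 (λ x z e → z :* (e :+ e) := (x :+ z) :* e :- (x :- z) :* e) refl x z e ⟩
    (x + z) * e - (x - z) * e      ≡⟨ cong₂ _-_ (sym ab≡[x+z]e) [x-z]e≡1 ⟩
    a * b - 1ℚ                     ∎

lemma2p1 : (x y z : ℚ) → 1ℚ + x * x ≡ y * y + z * z → x ≢ z →
             ∃₂ λ (a b : ℚ) → Σ (a ≢ b) λ a≢b →
               let instance _ = diff-nonZero a b a≢b in
               (x ≡ (a * b + 1ℚ) ÷ (a - b)) × (y ≡ (a + b) ÷ (a - b)) × (z ≡ (a * b - 1ℚ) ÷ (a - b))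
lemma2p1 x y z h x≢z =
  a , b , a≢b ,
  p*r≡q⇒p≡q÷r {{a-b≢0}} x[a-b]≡ab+1 ,
  p*r≡q⇒p≡q÷r {{a-b≢0}} y[a-b]≡a+b ,
  p*r≡q⇒p≡q÷r {{a-b≢0}} z[a-b]≡ab-1
  where
  open Slopes x y z h x≢z
  a-b≢0 : NonZero (a - b)
  a-b≢0 = diff-nonZero a b a≢b
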